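{- The category $\mathbf{SSys}$ is complete and cocomplete, and its limits and colimits are obtained by passing to $\mathcal{H}$ and then applying the simplification: for a small diagram $D$ in $\mathbf{SSys}$, a limit (resp. colimit) of $D$ is $\mathcal{S}_{\mathcal{H}}$ applied to a limit (resp. colimit) of $\mathcal{N}_{\mathcal{H}}\circ D$ in $\mathcal{H}$.
   Context: Let $\mathcal{P}:\mathbf{Set}\to\mathbf{Set}$ be the covariant power-set functor ($\mathcal{P}(g)(A)=g(A)$). $\mathcal{H}$ is the category of set-system hypergraphs, the comma category $(\mathrm{id}_{\mathbf{Set}}\downarrow\mathcal{P})$: objects are triples $(E,\epsilon,V)$ with sets $E,V$ and a function $\epsilon:E\to\mathcal{P}(V)$; morphisms $(E,\epsilon,V)\to(E',\epsilon',V')$ are pairs of functions $(\phi:E\to E',\psi:V\to V')$ with $\epsilon'\circ\phi=\mathcal{P}(\psi)\circ\epsilon$. $\mathbf{SSys}$ is the category of set systems: objects are pairs $(V,\beta)$ with $V$ a set and $\beta\subseteq\mathcal{P}(V)$; morphisms $(V,\beta)\to(V',\beta')$ are functions $g:V\to V'$ with $g(A)\in\beta'$ for all $A\in\beta$. The functor $\mathcal{N}_{\mathcal{H}}:\mathbf{SSys}\to\mathcal{H}$ sends $(V,\beta)$ to $(\beta,\iota_\beta,V)$ with $\iota_\beta$ the inclusion $\beta\hookrightarrow\mathcal{P}(V)$, and $g$ to $(\mathcal{P}(g)|_\beta,g)$. The simplification functor $\mathcal{S}_{\mathcal{H}}:\mathcal{H}\to\mathbf{SSys}$ sends $(E,\epsilon,V)$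 to $(V,\{\epsilon(e):e\in E\})$ and $(\phi,\psi)$ to $\psi$. -}

module Defs where

open import Level using (Level; _⊔_) renaming (suc to lsuc)
open import Data.Product using (Σ; _×_; _,_; proj₁; proj₂)
open import Relation.Binary.Bundles using (Setoid)
open import Relation.Binary.Structures using (IsEquivalence)
open import Relation.Binary.Core using (Rel)
open import Function.Bundles using (Func)

record Category (o h e : Level) : Set (lsuc (o ⊔ h ⊔ e)) where
  infixr 9 _∘_
  infix  4 _≈_
  field
    Obj      : Set o
    _⇒_      : Obj → Obj → Set h
    _≈_      : ∀ {A B} → Rel (A ⇒ B) e
    id       : ∀ {A} → A ⇒ A
    _∘_      : ∀ {A B C} → B ⇒ C → A ⇒ B → A ⇒ C
    equiv    : ∀ {A B} → IsEquivalence (_≈_ {A} {B})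
    ∘-resp-≈ : ∀ {A B C} {f g : B ⇒ C} {h i : A ⇒ B} → f ≈ g → h ≈ i → f ∘ h ≈ g ∘ i
    identityˡ : ∀ {A B} {f : A ⇒ B} → id ∘ f ≈ f
    identityʳ : ∀ {A B} {f : A ⇒ B} → f ∘ id ≈ f
    assoc    : ∀ {A B C D} {f : A ⇒ B} {g : B ⇒ C} {h : C ⇒ D} →
               (h ∘ g) ∘ f ≈ h ∘ (g ∘ f)

  module Eq {A B} = IsEquivalence (equiv {A} {B})

record Functor {o h e o′ h′ e′ : Level}
               (C : Category o h e) (D : Category o′ h′ e′)
               : Set (o ⊔ h ⊔ e ⊔ o′ ⊔ h′ ⊔ e′) where
  private
    module C = Category C
    module D = Category D
  field
    F₀           : C.Obj → D.Obj
    F₁           : ∀ {A B} → A C.⇒ B → F₀ A D.⇒ F₀ B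
    F-resp-≈     : ∀ {A B} {f g : A C.⇒ B} → f C.≈ g → F₁ f D.≈ F₁ g
    identity     : ∀ {A} → F₁ (C.id {A}) D.≈ D.id
    homomorphism : ∀ {A B C′} {f : A C.⇒ B} {g : B C.⇒ C′} →
                   F₁ (g C.∘ f) D.≈ F₁ g D.∘ F₁ f

open Functor

_∘F_ : ∀ {o₁ h₁ e₁ o₂ h₂ e₂ o₃ h₃ e₃}
         {A : Category o₁ h₁ e₁} {B : Category o₂ h₂ e₂} {C : Category o₃ h₃ e₃} →
       Functor B C → Functor A B → Functor A C
_∘F_ {C = C} G F = record
  { F₀ = λ X → F₀ G (F₀ F X)
  ; F₁ = λ f → F₁ G (F₁ F f)
  ; F-resp-≈ = λ p → F-resp-≈ G (F-resp-≈ F p)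
  ; identity = C.Eq.trans (F-resp-≈ G (identity F)) (identity G)
  ; homomorphism = C.Eq.trans (F-resp-≈ G (homomorphism F)) (homomorphism G)
  } where module C = Category C

module _ {o h e o′ h′ e′ : Level} {J : Category o h e} {C : Category o′ h′ e′}
         (F : Functor J C) where
  private
    module J = Category J
    module C = Category C

  record Cone : Set (o ⊔ h ⊔ o′ ⊔ h′ ⊔ e′) where
    field
      apex    : C.Obj
      leg     : ∀ j → apex C.⇒ F₀ F j
      commute : ∀ {i j} (f : i J.⇒ j) → F₁ F f C.∘ leg i C.≈ leg j

  record Cocone : Set (o ⊔ h ⊔ o′ ⊔ h′ ⊔ e′) where
    field
      coapex  : C.Obj
      coleg   : ∀ j → F₀ F j C.⇒ coapex
      commute : ∀ {i j} (f : i J.⇒ j) → coleg j C.∘ F₁ F f C.≈ coleg i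

  IsLimit : Cone → Set (o ⊔ h ⊔ o′ ⊔ h′ ⊔ e′)
  IsLimit L = ∀ (K : Cone) →
    Σ (Cone.apex K C.⇒ Cone.apex L) λ u →
      (∀ j → Cone.leg L j C.∘ u C.≈ Cone.leg K j) ×
      (∀ (v : Cone.apex K C.⇒ Cone.apex L) →
         (∀ j → Cone.leg L j C.∘ v C.≈ Cone.leg K j) → v C.≈ u)

  IsColimit : Cocone → Set (o ⊔ h ⊔ o′ ⊔ h′ ⊔ e′)
  IsColimit L = ∀ (K : Cocone) →
    Σ (Cocone.coapex L C.⇒ Cocone.coapex K) λ u →
      (∀ j → u C.∘ Cocone.coleg L j C.≈ Cocone.coleg K j) ×
      (∀ (v : Cocone.coapex L C.⇒ Cocone.coapex K) →
         (∀ j → v C.∘ Cocone.coleg L j C.≈ Cocone.coleg K j) → v C.≈ u)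

  Limit : Set (o ⊔ h ⊔ o′ ⊔ h′ ⊔ e′)
  Limit = Σ Cone IsLimit

  Colimit : Set (o ⊔ h ⊔ o′ ⊔ h′ ⊔ e′)
  Colimit = Σ Cocone IsColimit

module _ {ℓ : Level} (V : Setoid ℓ ℓ) where
  open Setoid V
  record Subset : Set (lsuc ℓ) where
    field
      mem  : Carrier → Set ℓ
      resp : ∀ {x y} → x ≈ y → mem x → mem y

open Subset public

infix 4 _≐_
record _≐_ {ℓ} {V : Setoid ℓ ℓ} (A B : Subset V) : Set ℓ where
  constructor mk≐
  field
    ⊆ : ∀ x → mem A x → mem B x
    ⊇ : ∀ x → mem B x → mem A x

≐-refl : ∀ {ℓ} {V : Setoid ℓ ℓ} {A : Subset V} → A ≐ A
≐-refl = mk≐ (λ _ p → p) (λ _ p → p)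

≐-sym : ∀ {ℓ} {V : Setoid ℓ ℓ} {A B : Subset V} → A ≐ B → B ≐ A
≐-sym (mk≐ p q) = mk≐ q p

≐-trans : ∀ {ℓ} {V : Setoid ℓ ℓ} {A B C : Subset V} → A ≐ B → B ≐ C → A ≐ C
≐-trans (mk≐ p q) (mk≐ r s) = mk≐ (λ x m → r x (p x m)) (λ x m → q x (s x m))

image : ∀ {ℓ} {V W : Setoid ℓ ℓ} → Func V W → Subset V → Subset W
image {V = V} {W = W} g A = record
  { mem  = λ y → Σ (Setoid.Carrier V) λ x → mem A x × (Func.to g x ≈ y)
  ; resp = λ { y≈z (x , a , gx≈y) → x , a , trans gx≈y y≈z }
  } where open Setoid W

idF : ∀ {a b} {V : Setoid a b} → Func V V
idF = record { to = λ x → x ; cong = λ p → p }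

_∘S_ : ∀ {a b c d e f} {U : Setoid a b} {V : Setoid c d} {W : Setoid e f} →
       Func V W → Func U V → Func U W
g ∘S f = record { to = λ x → Func.to g (Func.to f x)
                ; cong = λ p → Func.cong g (Func.cong f p) }

infix 4 _≗S_
_≗S_ : ∀ {ℓ} {V W : Setoid ℓ ℓ} → Rel (Func V W) ℓ
_≗S_ {W = W} f g = ∀ x → Setoid._≈_ W (Func.to f x) (Func.to g x)

≗S-equiv : ∀ {ℓ} {V W : Setoid ℓ ℓ} → IsEquivalence (_≗S_ {V = V} {W})
≗S-equiv {W = W} = record
  { refl = λ x → refl ; sym = λ p x → sym (p x) ; trans = λ p q x → trans (p x) (q x) }
  where open Setoid W

image-id : ∀ {ℓ} {V : Setoid ℓ ℓ} (A : Subset V) → image idF A ≐ A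
image-id {V = V} A = mk≐ (λ y → λ { (x , a , x≈y) → resp A x≈y a })
                         (λ y a → y , a , Setoid.refl V)

image-∘ : ∀ {ℓ} {U V W : Setoid ℓ ℓ} (g : Func V W) (f : Func U V) (A : Subset U) →
          image (g ∘S f) A ≐ image g (image f A)
image-∘ {V = V} {W} g f A = mk≐
    (λ z → λ { (x , a , p) → Func.to f x , (x , a , Setoid.refl V) , p })
    (λ z → λ { (y , (x , a , q) , p) → x , a , Setoid.trans W (Func.cong g q) p })

image-≗ : ∀ {ℓ} {V W : Setoid ℓ ℓ} {f g : Func V W} → f ≗S g → (A : Subset V) →
          image f A ≐ image g A
image-≗ {W = W} {f} {g} p A = mk≐
    (λ z → λ { (x , a , q) → x , a , Setoid.trans W (Setoid.sym W (p x)) q })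
    (λ z → λ { (x , a , q) → x , a , Setoid.trans W (p x) q })

image-≐ : ∀ {ℓ} {V W : Setoid ℓ ℓ} (f : Func V W) {A B : Subset V} → A ≐ B →
          image f A ≐ image f B
image-≐ f (mk≐ p q) = mk≐ (λ z → λ { (x , a , r) → x , p x a , r })
                          (λ z → λ { (x , b , r) → x , q x b , r })

record SetSystem (ℓ : Level) : Set (lsuc (lsuc ℓ)) where
  field
    V      : Setoid ℓ ℓ
    β      : Subset V → Set (lsuc ℓ)
    β-resp : ∀ {A B} → A ≐ B → β A → β B   -- β is a set of subsets (extensional)

record SSysHom {ℓ} (X Y : SetSystem ℓ) : Set (lsuc ℓ) where
  private
    module X = SetSystem X
    module Y = SetSystem Y
  field
    fun  : Func X.V Y.V
    pres : ∀ A → X.β A → Y.β (image fun A)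

open SSysHom public

SSys : (ℓ : Level) → Category (lsuc (lsuc ℓ)) (lsuc ℓ) ℓ
SSys ℓ = record
  { Obj = SetSystem ℓ
  ; _⇒_ = SSysHom
  ; _≈_ = λ {A} {B} f g → ∀ x → Setoid._≈_ (SetSystem.V B) (Func.to (fun f) x) (Func.to (fun g) x)
  ; id  = λ {X} → record { fun = idF
                         ; pres = λ A b → SetSystem.β-resp X (≐-sym (image-id A)) b }
  ; _∘_ = λ {X} {Y} {Z} g f → record
      { fun  = fun g ∘S fun f
      ; pres = λ A b → SetSystem.β-resp Z (≐-sym (image-∘ (fun g) (fun f) A))
                         (pres g _ (pres f A b)) }
  ; equiv = λ {A} {B} → record
      { refl  = λ x → Setoid.refl (SetSystem.V B)
      ; sym   = λ p x → Setoid.sym (SetSystem.V B) (p x)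
      ; trans = λ p q x → Setoid.trans (SetSystem.V B) (p x) (q x) }
  ; ∘-resp-≈ = λ {_} {_} {C} {f} {g} {h} {i} p q x →
      Setoid.trans (SetSystem.V C) (Func.cong (fun f) (q x)) (p (Func.to (fun i) x))
  ; identityˡ = λ {_} {B} x → Setoid.refl (SetSystem.V B)
  ; identityʳ = λ {_} {B} x → Setoid.refl (SetSystem.V B)
  ; assoc = λ {_} {_} {_} {D} x → Setoid.refl (SetSystem.V D)
  }

-- The category H of set-system hypergraphs  (id_Set ↓ P)

record Hypergraph (ℓ : Level) : Set (lsuc (lsuc ℓ)) where
  field
    E      : Setoid (lsuc ℓ) ℓ
    V      : Setoid ℓ ℓ
    ε      : Setoid.Carrier E → Subset V
    ε-resp : ∀ {e e′} → Setoid._≈_ E e e′ → ε e ≐ ε e′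

record HHom {ℓ} (X Y : Hypergraph ℓ) : Set (lsuc ℓ) where
  private
    module X = Hypergraph X
    module Y = Hypergraph Y
  field
    φ   : Func X.E Y.E
    ψ   : Func X.V Y.V
    sq  : ∀ e → Y.ε (Func.to φ e) ≐ image ψ (X.ε e)

open HHom public

H : (ℓ : Level) → Category (lsuc (lsuc ℓ)) (lsuc ℓ) (lsuc ℓ)
H ℓ = record
  { Obj = Hypergraph ℓ
  ; _⇒_ = HHom
  ; _≈_ = λ {A} {B} f g → (∀ e → Setoid._≈_ (Hypergraph.E B) (Func.to (φ f) e) (Func.to (φ g) e))
                × (∀ x → Setoid._≈_ (Hypergraph.V B) (Func.to (ψ f) x) (Func.to (ψ g) x))
  ; id  = λ {X} → record { φ = idF ; ψ = idF ; sq = λ e → ≐-sym (image-id _) }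
  ; _∘_ = λ {X} {Y} {Z} g f → record
      { φ = φ g ∘S φ f ; ψ = ψ g ∘S ψ f
      ; sq = λ e → ≐-trans (sq g _)
                  (≐-trans (image-≐ (ψ g) (sq f e))
                           (≐-sym (image-∘ (ψ g) (ψ f) (Hypergraph.ε X e)))) }
  ; equiv = λ {A} {B} → record
      { refl  = (λ e → Setoid.refl (Hypergraph.E B)) , (λ x → Setoid.refl (Hypergraph.V B))
      ; sym   = λ { (p , q) → (λ e → Setoid.sym (Hypergraph.E B) (p e))
                            , (λ x → Setoid.sym (Hypergraph.V B) (q x)) }
      ; trans = λ { (p , q) (r , s) → (λ e → Setoid.trans (Hypergraph.E B) (p e) (r e))
                                    , (λ x → Setoid.trans (Hypergraph.V B) (q x) (s x)) } }
  ; ∘-resp-≈ = λ {_} {_} {C} {f} {g} {h} {i} p q →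
        (λ e → Setoid.trans (Hypergraph.E C) (Func.cong (φ f) (proj₁ q e)) (proj₁ p (Func.to (φ i) e)))
      , (λ x → Setoid.trans (Hypergraph.V C) (Func.cong (ψ f) (proj₂ q x)) (proj₂ p (Func.to (ψ i) x)))
  ; identityˡ = λ {_} {B} → (λ e → Setoid.refl (Hypergraph.E B)) , (λ x → Setoid.refl (Hypergraph.V B))
  ; identityʳ = λ {_} {B} → (λ e → Setoid.refl (Hypergraph.E B)) , (λ x → Setoid.refl (Hypergraph.V B))
  ; assoc = λ {_} {_} {_} {D} → (λ e → Setoid.refl (Hypergraph.E D)) , (λ x → Setoid.refl (Hypergraph.V D))
  }

edgeSetoid : ∀ {ℓ} (X : SetSystem ℓ) → Setoid (lsuc ℓ) ℓ
edgeSetoid X = record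
  { Carrier = Σ (Subset (SetSystem.V X)) (SetSystem.β X)
  ; _≈_ = λ a b → proj₁ a ≐ proj₁ b
  ; isEquivalence = record { refl = ≐-refl ; sym = ≐-sym ; trans = ≐-trans } }

N-H : ∀ {ℓ} → Functor (SSys ℓ) (H ℓ)
N-H = record
  { F₀ = λ X → record { E = edgeSetoid X ; V = SetSystem.V X ; ε = proj₁ ; ε-resp = λ p → p }
  ; F₁ = λ g → record
      { φ = record { to = λ a → image (fun g) (proj₁ a) , pres g (proj₁ a) (proj₂ a)
                   ; cong = λ p → image-≐ (fun g) p }
      ; ψ = fun g
      ; sq = λ e → ≐-refl }
  ; F-resp-≈ = λ {_} {_} {f} {g} p → (λ e → image-≗ {f = fun f} {g = fun g} p (proj₁ e)) , p
  ; identity = λ {A} → (λ e → image-id (proj₁ e)) , (λ x → Setoid.refl (SetSystem.V A))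
  ; homomorphism = λ {_} {_} {C} {f} {g} →
      (λ e → image-∘ (fun g) (fun f) (proj₁ e)) , (λ x → Setoid.refl (SetSystem.V C))
  }

S₀ : ∀ {ℓ} → Hypergraph ℓ → SetSystem ℓ
S₀ X = record
  { V = Hypergraph.V X
  ; β = λ A → Σ (Setoid.Carrier (Hypergraph.E X)) λ e → Hypergraph.ε X e ≐ A
  ; β-resp = λ { p (e , q) → e , ≐-trans q p } }

S-H : ∀ {ℓ} → Functor (H ℓ) (SSys ℓ)
S-H = record
  { F₀ = S₀
  ; F₁ = λ f → record
      { fun = ψ f
      ; pres = λ { A (e , q) → Func.to (φ f) e , ≐-trans (sq f e) (image-≐ (ψ f) q) } }
  ; F-resp-≈ = proj₂
  ; identity = λ {A} x → Setoid.refl (Hypergraph.V A)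
  ; homomorphism = λ {_} {_} {C} x → Setoid.refl (Hypergraph.V C)
  }

-- S_H ∘ N_H is the identity on the nose in set theory; here S_H(N_H X) and X
-- differ only in how the (same) set β is presented, identified by this
-- identity-on-vertices isomorphism.
counit : ∀ {ℓ} (X : SetSystem ℓ) → SSysHom (S₀ (Functor.F₀ N-H X)) X
counit X = record
  { fun = idF
  ; pres = λ { A ((B , b) , q) →
      SetSystem.β-resp X (≐-trans q (≐-sym (image-id A))) b } }

unit : ∀ {ℓ} (X : SetSystem ℓ) → SSysHom X (S₀ (Functor.F₀ N-H X))
unit X = record
  { fun = idF
  ; pres = λ A b → (A , b) , ≐-sym (image-id A) }

module _ {ℓ} {J : Category ℓ ℓ ℓ} (D : Functor J (SSys ℓ)) where
  private module SS = Category (SSys ℓ)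

  S-cone : Cone (N-H ∘F D) → Cone D
  S-cone L = record
    { apex    = S₀ (Cone.apex L)
    ; leg     = λ j → counit (F₀ D j) SS.∘ F₁ S-H (Cone.leg L j)
    ; commute = λ f → proj₂ (Cone.commute L f)
    }

  S-cocone : Cocone (N-H ∘F D) → Cocone D
  S-cocone L = record
    { coapex  = S₀ (Cocone.coapex L)
    ; coleg   = λ j → F₁ S-H (Cocone.coleg L j) SS.∘ unit (F₀ D j)
    ; commute = λ f → proj₂ (Cocone.commute L f)
    }

-- Limits in SSys are compatible families of vertices, with A an edge when every projection
-- of A is an edge; colimits glue the vertex setoids along the diagram, the edges being the
-- images of the edges of the pieces. To see that S_H preserves (co)limits, a (co)cone K over D is sent by
-- N_H to a (co)cone over N_H ∘ D; the vertex part of its factorisation through the H-(co)limit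
-- L is a set-system morphism into (out of) S_H L. Uniqueness only concerns vertex maps, and
-- the vertex legs of an H-limit (H-colimit) are jointly monic (epic): any vertex map out of a
-- hypergraph without edges, or into the hypergraph whose edges are all subsets, is an H-morphism.
module Submission where

open import Defs
open import Level using (Level)
open import Data.Product using (_×_; Σ; _,_; proj₁; proj₂)
open import Data.Empty.Polymorphic using (⊥)
open import Relation.Binary.Bundles using (Setoid)
import Relation.Binary.Construct.Closure.Equivalence as EqClosure
import Relation.Binary.Construct.Always as Always
open import Function.Bundles using (Func)
open Functor

module _ {o h e o′ h′ e′ : Level} {J : Category o h e} {C : Category o′ h′ e′} {D : Functor J C} where
  open Category C

  limit-jointly-monic : (L : Cone D) → IsLimit D L → ∀ {X} (v w : X ⇒ Cone.apex L) →
    (∀ j → Cone.leg L j ∘ v ≈ Cone.leg L j ∘ w) → v ≈ w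
  limit-jointly-monic L isLimit {X} v w legs-agree =
    Eq.trans (factor-unique v legs-agree) (Eq.sym (factor-unique w (λ _ → Eq.refl)))
    where
    throughW : Cone D
    throughW = record
      { apex    = X
      ; leg     = λ j → Cone.leg L j ∘ w
      ; commute = λ f → Eq.trans (Eq.sym assoc) (∘-resp-≈ (Cone.commute L f) Eq.refl)
      }
    factor-unique : ∀ u → (∀ j → Cone.leg L j ∘ u ≈ Cone.leg L j ∘ w) → u ≈ proj₁ (isLimit throughW)
    factor-unique = proj₂ (proj₂ (isLimit throughW))

  colimit-jointly-epic : (L : Cocone D) → IsColimit D L → ∀ {X} (v w : Cocone.coapex L ⇒ X) →
    (∀ j → v ∘ Cocone.coleg L j ≈ w ∘ Cocone.coleg L j) → v ≈ w
  colimit-jointly-epic L isColimit {X} v w colegs-agree =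
    Eq.trans (factor-unique v colegs-agree) (Eq.sym (factor-unique w (λ _ → Eq.refl)))
    where
    throughW : Cocone D
    throughW = record
      { coapex  = X
      ; coleg   = λ j → w ∘ Cocone.coleg L j
      ; commute = λ f → Eq.trans assoc (∘-resp-≈ Eq.refl (Cocone.commute L f))
      }
    factor-unique : ∀ u → (∀ j → u ∘ Cocone.coleg L j ≈ w ∘ Cocone.coleg L j) → u ≈ proj₁ (isColimit throughW)
    factor-unique = proj₂ (proj₂ (isColimit throughW))

module _ {o h e o′ h′ e′ o″ h″ e″ : Level} {J : Category o h e} {C : Category o′ h′ e′}
         {C′ : Category o″ h″ e″} (F : Functor C C′) {D : Functor J C} where
  private module C′ = Category C′

  mapCone : Cone D → Cone (F ∘F D)
  mapCone K = record
    { apex    = F₀ F (Cone.apex K)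
    ; leg     = λ j → F₁ F (Cone.leg K j)
    ; commute = λ f → C′.Eq.trans (C′.Eq.sym (homomorphism F)) (F-resp-≈ F (Cone.commute K f))
    }

  mapCocone : Cocone D → Cocone (F ∘F D)
  mapCocone K = record
    { coapex  = F₀ F (Cocone.coapex K)
    ; coleg   = λ j → F₁ F (Cocone.coleg K j)
    ; commute = λ f → C′.Eq.trans (C′.Eq.sym (homomorphism F)) (F-resp-≈ F (Cocone.commute K f))
    }

image-∘-agree : ∀ {ℓ} {U V W : Setoid ℓ ℓ} (g : Func U V) (v w : Func V W) →
  v ∘S g ≗S w ∘S g → (B : Subset U) → image v (image g B) ≐ image w (image g B)
image-∘-agree g v w agree B =
  ≐-trans (≐-sym (image-∘ v g B)) (≐-trans (image-≗ {f = v ∘S g} {g = w ∘S g} agree B) (image-∘ w g B))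

module _ {ℓ : Level} where
  private module Hℓ = Category (H ℓ)

  edgeless : Setoid ℓ ℓ → Hypergraph ℓ
  edgeless W = record
    { E = Always.setoid ⊥ ℓ ; V = W ; ε = λ () ; ε-resp = λ { {()} } }

  fromEdgeless : ∀ {W X} → Func W (Hypergraph.V X) → HHom (edgeless W) X
  fromEdgeless v = record { φ = record { to = λ () ; cong = λ { {()} } } ; ψ = v ; sq = λ () }

  allSubsets : Setoid ℓ ℓ → Hypergraph ℓ
  allSubsets W = record
    { E      = record { Carrier = Subset W ; _≈_ = _≐_
                      ; isEquivalence = record { refl = ≐-refl ; sym = ≐-sym ; trans = ≐-trans } }
    ; V      = W
    ; ε      = λ A → A
    ; ε-resp = λ p → p
    }

  toAllSubsets : ∀ {X W} → Func (Hypergraph.V X) W → HHom X (allSubsets W)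
  toAllSubsets {X} v = record
    { φ  = record { to = λ e → image v (Hypergraph.ε X e)
                  ; cong = λ p → image-≐ v (Hypergraph.ε-resp X p) }
    ; ψ  = v
    ; sq = λ _ → ≐-refl
    }

  toAllSubsets-∘-agree : ∀ {X Y W} (f : HHom Y X) (v w : Func (Hypergraph.V X) W) →
    v ∘S ψ f ≗S w ∘S ψ f → toAllSubsets v Hℓ.∘ f Hℓ.≈ toAllSubsets w Hℓ.∘ f
  toAllSubsets-∘-agree {Y = Y} f v w agree =
      (λ e → ≐-trans (image-≐ v (sq f e))
               (≐-trans (image-∘-agree (ψ f) v w agree (Hypergraph.ε Y e))
                        (image-≐ w (≐-sym (sq f e)))))
    , agree

  module _ {o h e} {J : Category o h e} {G : Functor J (H ℓ)} where

    limit-ψ-jointly-monic : (L : Cone G) → IsLimit G L → ∀ {W} (v w : Func W (Hypergraph.V (Cone.apex L))) →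
      (∀ j → ψ (Cone.leg L j) ∘S v ≗S ψ (Cone.leg L j) ∘S w) → v ≗S w
    limit-ψ-jointly-monic L isLimit v w agree =
      proj₂ (limit-jointly-monic L isLimit (fromEdgeless v) (fromEdgeless w) (λ j → (λ ()) , agree j))

    colimit-ψ-jointly-epic : (L : Cocone G) → IsColimit G L → ∀ {W} (v w : Func (Hypergraph.V (Cocone.coapex L)) W) →
      (∀ j → v ∘S ψ (Cocone.coleg L j) ≗S w ∘S ψ (Cocone.coleg L j)) → v ≗S w
    colimit-ψ-jointly-epic L isColimit v w agree =
      proj₂ (colimit-jointly-epic L isColimit (toAllSubsets v) (toAllSubsets w)
               (λ j → toAllSubsets-∘-agree (Cocone.coleg L j) v w (agree j)))

module _ {ℓ} {J : Category ℓ ℓ ℓ} (D : Functor J (SSys ℓ)) where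
  private
    module J = Category J
    module SS = Category (SSys ℓ)

    Vtx : J.Obj → Setoid ℓ ℓ
    Vtx j = SetSystem.V (F₀ D j)

    module Vtx j = Setoid (Vtx j)

    mapVtx : ∀ {i j} → i J.⇒ j → Func (Vtx i) (Vtx j)
    mapVtx f = fun (F₁ D f)

  compatibleFamilies : Setoid ℓ ℓ
  compatibleFamilies = record
    { Carrier = Σ (∀ j → Vtx.Carrier j) λ x →
        ∀ {i j} (f : i J.⇒ j) → Setoid._≈_ (Vtx j) (Func.to (mapVtx f) (x i)) (x j)
    ; _≈_ = λ x y → ∀ j → Setoid._≈_ (Vtx j) (proj₁ x j) (proj₁ y j)
    ; isEquivalence = record
        { refl = λ j → Vtx.refl j ; sym = λ p j → Vtx.sym j (p j) ; trans = λ p q j → Vtx.trans j (p j) (q j) }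
    }

  project : ∀ j → Func compatibleFamilies (Vtx j)
  project j = record { to = λ x → proj₁ x j ; cong = λ p → p j }

  limitCone : Cone D
  limitCone = record
    { apex    = record
        { V      = compatibleFamilies
        ; β      = λ A → ∀ j → SetSystem.β (F₀ D j) (image (project j) A)
        ; β-resp = λ p edge j → SetSystem.β-resp (F₀ D j) (image-≐ (project j) p) (edge j) }
    ; leg     = λ j → record { fun = project j ; pres = λ _ edge → edge j }
    ; commute = λ f x → proj₂ x f
    }

  limitCone-isLimit : IsLimit D limitCone
  limitCone-isLimit K = factor , (λ j _ → Vtx.refl j) , (λ _ legs x j → legs j x)
    where
    tuple : Func (SetSystem.V (Cone.apex K)) compatibleFamilies
    tuple = record
      { to   = λ x → (λ j → Func.to (fun (Cone.leg K j)) x) , λ f → Cone.commute K f x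
      ; cong = λ p j → Func.cong (fun (Cone.leg K j)) p }

    factor : SSysHom (Cone.apex K) (Cone.apex limitCone)
    factor = record
      { fun  = tuple
      ; pres = λ A edge j → SetSystem.β-resp (F₀ D j) (image-∘ (project j) tuple A)
                              (pres (Cone.leg K j) A edge) }

  Point : Set ℓ
  Point = Σ J.Obj Vtx.Carrier

  data Glue : Point → Point → Set ℓ where
    within : ∀ {j x y} → Setoid._≈_ (Vtx j) x y → Glue (j , x) (j , y)
    along  : ∀ {i j} (f : i J.⇒ j) x → Glue (i , x) (j , Func.to (mapVtx f) x)

  glued : Setoid ℓ ℓ
  glued = EqClosure.setoid Glue

  inject : ∀ j → Func (Vtx j) glued
  inject j = record { to = λ x → j , x ; cong = λ p → EqClosure.return (within p) }

  colimitCocone : Cocone D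
  colimitCocone = record
    { coapex  = record
        { V      = glued
        ; β      = λ A → Σ J.Obj λ j → Σ (Subset (Vtx j)) λ B →
                     SetSystem.β (F₀ D j) B × (A ≐ image (inject j) B)
        ; β-resp = λ { p (j , B , edge , q) → j , B , edge , ≐-trans (≐-sym p) q } }
    ; coleg   = λ j → record { fun = inject j ; pres = λ B edge → j , B , edge , ≐-refl }
    ; commute = λ f x → EqClosure.symmetric Glue (EqClosure.return (along f x))
    }

  colimitCocone-isColimit : IsColimit D colimitCocone
  colimitCocone-isColimit K = factor , (λ _ _ → Y.refl) , (λ _ colegs x → colegs (proj₁ x) (proj₂ x))
    where
    Y : SetSystem ℓ
    Y = Cocone.coapex K
    module Y = Setoid (SetSystem.V Y)

    copair : Point → Y.Carrier
    copair (j , x) = Func.to (fun (Cocone.coleg K j)) x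

    copair-respects-Glue : ∀ {a b} → Glue a b → copair a Y.≈ copair b
    copair-respects-Glue (within {j} p) = Func.cong (fun (Cocone.coleg K j)) p
    copair-respects-Glue (along f x)    = Y.sym (Cocone.commute K f x)

    copairF : Func glued (SetSystem.V Y)
    copairF = record
      { to   = copair
      ; cong = EqClosure.gfold Y.isEquivalence copair copair-respects-Glue }

    factor : SSysHom (Cocone.coapex colimitCocone) Y
    factor = record
      { fun  = copairF
      ; pres = λ { A (j , B , edge , A≐B) → SetSystem.β-resp Y
                     (≐-sym (≐-trans (image-≐ copairF A≐B) (≐-sym (image-∘ copairF (inject j) B))))
                     (pres (Cocone.coleg K j) B edge) } }

  S-cone-isLimit : (L : Cone (N-H ∘F D)) → IsLimit (N-H ∘F D) L → IsLimit D (S-cone D L)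
  S-cone-isLimit L isLimit K with isLimit (mapCone N-H K)
  ... | hyperFactor , factors , _ = factor , (λ j → proj₂ (factors j)) , unique
    where
    factor : SSysHom (Cone.apex K) (S₀ (Cone.apex L))
    factor = F₁ S-H hyperFactor SS.∘ unit (Cone.apex K)

    unique : ∀ v → (∀ j → S-cone D L .Cone.leg j SS.∘ v SS.≈ Cone.leg K j) → v SS.≈ factor
    unique v legs = limit-ψ-jointly-monic L isLimit (fun v) (fun factor)
      (λ j x → Vtx.trans j (legs j x) (Vtx.sym j (proj₂ (factors j) x)))

  S-cocone-isColimit : (L : Cocone (N-H ∘F D)) → IsColimit (N-H ∘F D) L → IsColimit D (S-cocone D L)
  S-cocone-isColimit L isColimit K with isColimit (mapCocone N-H K)
  ... | hyperFactor , factors , _ = factor , (λ j → proj₂ (factors j)) , unique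
    where
    module Y = Setoid (SetSystem.V (Cocone.coapex K))

    factor : SSysHom (S₀ (Cocone.coapex L)) (Cocone.coapex K)
    factor = counit (Cocone.coapex K) SS.∘ F₁ S-H hyperFactor

    unique : ∀ v → (∀ j → v SS.∘ S-cocone D L .Cocone.coleg j SS.≈ Cocone.coleg K j) → v SS.≈ factor
    unique v colegs = colimit-ψ-jointly-epic L isColimit (fun v) (fun factor)
      (λ j x → Y.trans (colegs j x) (Y.sym (proj₂ (factors j) x)))

mainTheorem9 : ∀ {ℓ} (J : Category ℓ ℓ ℓ) (D : Functor J (SSys ℓ)) →
    (Limit D × (∀ (L : Cone (N-H ∘F D)) → IsLimit (N-H ∘F D) L → IsLimit D (S-cone D L)))
    × (Colimit D × (∀ (L : Cocone (N-H ∘F D)) → IsColimit (N-H ∘F D) L → IsColimit D (S-cocone D L)))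
mainTheorem9 J D =
    ((limitCone D , limitCone-isLimit D) , S-cone-isLimit D)
  , ((colimitCocone D , colimitCocone-isColimit D) , S-cocone-isColimit D)
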